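{- Let $\sim$ denote either $\cong$ or $\simeq$, and let $A,B,C,D$ be type expressions. (1) $\bullet A\sim\bullet B$ if and only if $A\sim B$. (2) $A\to B\sim C\to D$ if and only if either (a) $A\sim C$ and $B\sim D$, or (b) $B\sim D\sim\top$.
   Context: Pseudo type expressions: $A::=X\mid A\to B\mid \bullet A\mid \mu X.A$ over a countable set of type variables ($\alpha$-equivalent ones identified; $A[B/X]$ capture-avoiding substitution). $\top:=\mu X.\bullet X$. Tail: $t(X)=X$, $t(A\to B)=t(B)$, $t(\bullet A)=\bullet t(A)$, $t(\mu X.A)=\mu X.t(A)$. $A$ is a $\top$-variant iff $t(A)=\bullet^{m_0}\mu X_1.\bullet^{m_1}\cdots\mu X_n.\bullet^{m_n}X_i$ with $1\le i\le n$, $X_i\notin\{X_{i+1},\dots,X_n\}$, $m_i+\dots+m_n\ge1$ ($\bullet^m$ denotes $m$ bullets). Properness in $X$: variable $Y$ iff $Y\ne X$; $\bullet A$ always; $A\to B$ iff both are, or $B$ is a $\top$-variant; $\mu Y.A$ ($Y\ne X$) iff $A$ is, or $\mu Y.A$ is a $\top$-variant. Type expressions: pseudo type expressions in which every $\mu X.A$ has $A$ proper in $X$. $\cong$ is the smallest relation on type expressions closed under: reflexivity, symmetry, transitivity; $A\cong B\Rightarrow\bullet A\cong\bullet B$; $A\cong C,B\cong D\Rightarrow A\to B\cong C\to D$; $A\to\top\cong\top$; $\mu X.A\cong A[\mu X.A/X]$; if $A\cong C[A/X]$ and $C$ is proper in $X$ then $A\cong\mu X.C$. $\simeq$ is defined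 by the same rules plus $\bullet(A\to B)\simeq\bullet A\to\bullet B$. -}

module Defs where

open import Data.Nat using (ℕ; zero; suc; _≤_; _<_; _∸_)
open import Data.List using (List; []; _∷_; length; reverse; take)
open import Data.Nat.ListAction using (sum)
open import Data.Bool using (Bool; true; false)
open import Data.Product using (Σ; _×_; ∃-syntax)
open import Data.Sum using (_⊎_)
open import Relation.Binary.PropositionalEquality using (_≡_; _≢_)

-- Pseudo type expressions, with variables as de Bruijn indices
-- (so alpha-equivalent expressions are literally equal).
data Ty : Set where
  var : ℕ → Ty
  _⇒_ : Ty → Ty → Ty
  ● : Ty → Ty
  μ : Ty → Ty   -- binds index 0 in the body

infixr 5 _⇒_

ext : (ℕ → ℕ) → ℕ → ℕ
ext ρ zero = zero
ext ρ (suc n) = suc (ρ n)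

rename : (ℕ → ℕ) → Ty → Ty
rename ρ (var n) = var (ρ n)
rename ρ (A ⇒ B) = rename ρ A ⇒ rename ρ B
rename ρ (● A) = ● (rename ρ A)
rename ρ (μ A) = μ (rename (ext ρ) A)

exts : (ℕ → Ty) → ℕ → Ty
exts σ zero = var zero
exts σ (suc n) = rename suc (σ n)

subst : (ℕ → Ty) → Ty → Ty
subst σ (var n) = σ n
subst σ (A ⇒ B) = subst σ A ⇒ subst σ B
subst σ (● A) = ● (subst σ A)
subst σ (μ A) = μ (subst (exts σ) A)

sub0 : Ty → ℕ → Ty
sub0 B zero = B
sub0 B (suc n) = var n

_[_/0] : Ty → Ty → Ty
A [ B /0] = subst (sub0 B) A

⊤ᵗ : Ty
⊤ᵗ = μ (● (var zero))

tail : Ty → Ty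
tail (var n) = var n
tail (A ⇒ B) = tail B
tail (● A) = ● (tail A)
tail (μ A) = μ (tail A)

bullets : ℕ → Ty → Ty
bullets zero A = A
bullets (suc m) A = ● (bullets m A)

topForm : ℕ → List ℕ → ℕ → Ty
topForm m₀ [] k = bullets m₀ (var k)
topForm m₀ (m₁ ∷ ms) k = bullets m₀ (μ (topForm m₁ ms k))

-- ⊤-variant: t(A) = •^{m₀} μX₁.•^{m₁} ⋯ μXₙ.•^{mₙ} X_i with X_i bound by the
-- i-th μ (de Bruijn index k = n - i < n), and m_i + ⋯ + m_n ≥ 1
-- (these are the last k+1 of m₁,…,mₙ).
IsTopVariant : Ty → Set
IsTopVariant A =
  ∃[ m₀ ] ∃[ ms ] ∃[ k ]
    (tail A ≡ topForm m₀ ms k × k < length ms × 1 ≤ sum (take (suc k) (reverse ms)))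

data Proper : ℕ → Ty → Set where
  pvar  : ∀ {j k} → k ≢ j → Proper j (var k)
  pbul  : ∀ {j A} → Proper j (● A)
  parr  : ∀ {j A B} → Proper j A → Proper j B → Proper j (A ⇒ B)
  parrT : ∀ {j A B} → IsTopVariant B → Proper j (A ⇒ B)
  pmu   : ∀ {j A} → Proper (suc j) A → Proper j (μ A)
  pmuT  : ∀ {j A} → IsTopVariant (μ A) → Proper j (μ A)

data IsType : Ty → Set where
  tvar : ∀ {n} → IsType (var n)
  tarr : ∀ {A B} → IsType A → IsType B → IsType (A ⇒ B)
  tbul : ∀ {A} → IsType A → IsType (● A)
  tmu  : ∀ {A} → IsType A → Proper zero A → IsType (μ A)

-- Type equivalence on type expressions. With flag false this is ≅,
-- with flag true it is ≃ (extra rule •(A→B) ≃ •A → •B).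
data Equiv (d : Bool) : Ty → Ty → Set where
  e-refl  : ∀ {A} → IsType A → Equiv d A A
  e-sym   : ∀ {A B} → Equiv d A B → Equiv d B A
  e-trans : ∀ {A B C} → Equiv d A B → Equiv d B C → Equiv d A C
  e-bul   : ∀ {A B} → Equiv d A B → Equiv d (● A) (● B)
  e-arr   : ∀ {A B C D} → Equiv d A C → Equiv d B D → Equiv d (A ⇒ B) (C ⇒ D)
  e-top   : ∀ {A} → IsType A → Equiv d (A ⇒ ⊤ᵗ) ⊤ᵗ
  e-fold  : ∀ {A} → IsType (μ A) → Equiv d (μ A) (A [ μ A /0])
  e-contr : ∀ {A C} → IsType C → Proper zero C →
            Equiv d A (C [ A /0]) → Equiv d A (μ C)
  e-dist  : ∀ {A B} → d ≡ true → IsType A → IsType B →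
            Equiv d (● (A ⇒ B)) (● A ⇒ ● B)

_≅_ : Ty → Ty → Set
_≅_ = Equiv false

_≃_ : Ty → Ty → Set
_≃_ = Equiv true

module Submission where

-- The "if" directions are immediate from the congruence rules and A→⊤ ∼ ⊤.
-- For the "only if" directions we use syntactic maps that are invariant
-- under ∼ (i.e. send equivalent types to equivalent types):
--   * peel, which removes the outermost bullet on every branch of a type
--     (unfolding a μ once); peel (•A) = A, so (1) follows;
--   * component s, which selects the domain or the codomain of an arrow
--     (unfolding μ's and going under bullets); it is invariant under ∼,
--     except that for the domain the rule A→⊤ ∼ ⊤ may intervene, in which
--     case the arrow is equivalent to ⊤.  The μ-rules need
-- that the maps commute with substitution (up to ∼), which in turn needs
-- the syntactic theory of de Bruijn substitution, stability of properness
-- and well-formedness under substitution, and the fact that every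
-- ⊤-variant is ∼ ⊤ (where properness is used through the unique-fixed-point
-- rule).

open import Defs
open import Data.Bool using (Bool)
open import Data.Nat using (ℕ; zero; suc; _≤_; _+_; _∸_; z≤n; s≤s; _≟_)
open import Data.Nat.Properties
  using (suc-injective; ≤-trans; ≤-reflexive; <⇒≱; m≤n+m; +-identityʳ; +-suc)
open import Data.List using ([]; _∷_; length)
open import Data.Product using (_×_; _,_; proj₁; proj₂; ∃-syntax)
open import Data.Sum using (_⊎_; inj₁; inj₂)
import Data.Sum as Sum
open import Data.Empty using (⊥; ⊥-elim)
open import Relation.Nullary using (Dec; yes; no)
open import Relation.Binary.PropositionalEquality as Eq
  using (_≡_; _≢_; refl; sym; trans; cong; cong₂)
open import Function.Bundles using (_⇔_; mk⇔)

ext-cong : ∀ {ρ ρ′ : ℕ → ℕ} → (∀ n → ρ n ≡ ρ′ n) → ∀ n → ext ρ n ≡ ext ρ′ n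
ext-cong e zero = refl
ext-cong e (suc n) = cong suc (e n)

rename-cong : ∀ {ρ ρ′} → (∀ n → ρ n ≡ ρ′ n) → ∀ A → rename ρ A ≡ rename ρ′ A
rename-cong e (var n) = cong var (e n)
rename-cong e (A ⇒ B) = cong₂ _⇒_ (rename-cong e A) (rename-cong e B)
rename-cong e (● A) = cong ● (rename-cong e A)
rename-cong e (μ A) = cong μ (rename-cong (ext-cong e) A)

exts-cong : ∀ {σ τ : ℕ → Ty} → (∀ n → σ n ≡ τ n) → ∀ n → exts σ n ≡ exts τ n
exts-cong e zero = refl
exts-cong e (suc n) = cong (rename suc) (e n)

subst-cong : ∀ {σ τ} → (∀ n → σ n ≡ τ n) → ∀ A → subst σ A ≡ subst τ A
subst-cong e (var n) = e n
subst-cong e (A ⇒ B) = cong₂ _⇒_ (subst-cong e A) (subst-cong e B)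
subst-cong e (● A) = cong ● (subst-cong e A)
subst-cong e (μ A) = cong μ (subst-cong (exts-cong e) A)

rename-rename : ∀ ρ ρ′ A → rename ρ (rename ρ′ A) ≡ rename (λ n → ρ (ρ′ n)) A
rename-rename ρ ρ′ (var n) = refl
rename-rename ρ ρ′ (A ⇒ B) = cong₂ _⇒_ (rename-rename ρ ρ′ A) (rename-rename ρ ρ′ B)
rename-rename ρ ρ′ (● A) = cong ● (rename-rename ρ ρ′ A)
rename-rename ρ ρ′ (μ A) =
  cong μ (trans (rename-rename (ext ρ) (ext ρ′) A) (rename-cong ext-comp A))
  where
  ext-comp : ∀ n → ext ρ (ext ρ′ n) ≡ ext (λ n → ρ (ρ′ n)) n
  ext-comp zero = refl
  ext-comp (suc n) = refl

rename-subst : ∀ ρ σ A → rename ρ (subst σ A) ≡ subst (λ n → rename ρ (σ n)) A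
rename-subst ρ σ (var n) = refl
rename-subst ρ σ (A ⇒ B) = cong₂ _⇒_ (rename-subst ρ σ A) (rename-subst ρ σ B)
rename-subst ρ σ (● A) = cong ● (rename-subst ρ σ A)
rename-subst ρ σ (μ A) =
  cong μ (trans (rename-subst (ext ρ) (exts σ) A) (subst-cong ext-exts A))
  where
  ext-exts : ∀ n → rename (ext ρ) (exts σ n) ≡ exts (λ n → rename ρ (σ n)) n
  ext-exts zero = refl
  ext-exts (suc n) =
    trans (rename-rename (ext ρ) suc (σ n)) (sym (rename-rename suc ρ (σ n)))

subst-rename : ∀ σ ρ A → subst σ (rename ρ A) ≡ subst (λ n → σ (ρ n)) A
subst-rename σ ρ (var n) = refl
subst-rename σ ρ (A ⇒ B) = cong₂ _⇒_ (subst-rename σ ρ A) (subst-rename σ ρ B)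
subst-rename σ ρ (● A) = cong ● (subst-rename σ ρ A)
subst-rename σ ρ (μ A) =
  cong μ (trans (subst-rename (exts σ) (ext ρ) A) (subst-cong exts-ext A))
  where
  exts-ext : ∀ n → exts σ (ext ρ n) ≡ exts (λ n → σ (ρ n)) n
  exts-ext zero = refl
  exts-ext (suc n) = refl

subst-subst : ∀ σ τ A → subst σ (subst τ A) ≡ subst (λ n → subst σ (τ n)) A
subst-subst σ τ (var n) = refl
subst-subst σ τ (A ⇒ B) = cong₂ _⇒_ (subst-subst σ τ A) (subst-subst σ τ B)
subst-subst σ τ (● A) = cong ● (subst-subst σ τ A)
subst-subst σ τ (μ A) =
  cong μ (trans (subst-subst (exts σ) (exts τ) A) (subst-cong exts-exts A))
  where
  exts-exts : ∀ n → subst (exts σ) (exts τ n) ≡ exts (λ n → subst σ (τ n)) n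
  exts-exts zero = refl
  exts-exts (suc n) =
    trans (subst-rename (exts σ) suc (τ n)) (sym (rename-subst suc σ (τ n)))

subst-id : ∀ A → subst var A ≡ A
subst-id (var n) = refl
subst-id (A ⇒ B) = cong₂ _⇒_ (subst-id A) (subst-id B)
subst-id (● A) = cong ● (subst-id A)
subst-id (μ A) = cong μ (trans (subst-cong exts-var A) (subst-id A))
  where
  exts-var : ∀ n → exts var n ≡ var n
  exts-var zero = refl
  exts-var (suc n) = refl

rename-as-subst : ∀ ρ A → rename ρ A ≡ subst (λ n → var (ρ n)) A
rename-as-subst ρ A = trans (sym (subst-id (rename ρ A))) (subst-rename var ρ A)

cons : Ty → (ℕ → Ty) → ℕ → Ty
cons T σ zero = T
cons T σ (suc n) = σ n

subst-[/0] : ∀ σ X Y → subst σ (X [ Y /0]) ≡ subst (cons (subst σ Y) σ) X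
subst-[/0] σ X Y = trans (subst-subst σ (sub0 Y) X) (subst-cong pointwise X)
  where
  pointwise : ∀ n → subst σ (sub0 Y n) ≡ cons (subst σ Y) σ n
  pointwise zero = refl
  pointwise (suc n) = refl

exts-[/0] : ∀ σ X T → (subst (exts σ) X) [ T /0] ≡ subst (cons T σ) X
exts-[/0] σ X T = trans (subst-subst (sub0 T) (exts σ) X) (subst-cong pointwise X)
  where
  pointwise : ∀ n → subst (sub0 T) (exts σ n) ≡ cons T σ n
  pointwise zero = refl
  pointwise (suc n) = trans (subst-rename (sub0 T) suc (σ n)) (subst-id (σ n))

subst-fusion : ∀ σ X Y → subst σ (X [ Y /0]) ≡ (subst (exts σ) X) [ subst σ Y /0]
subst-fusion σ X Y = trans (subst-[/0] σ X Y) (sym (exts-[/0] σ X (subst σ Y)))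

rename-fusion : ∀ ρ X Y → rename ρ (X [ Y /0]) ≡ (rename (ext ρ) X) [ rename ρ Y /0]
rename-fusion ρ X Y =
  trans (rename-subst ρ (sub0 Y) X)
    (trans (subst-cong pointwise X) (sym (subst-rename (sub0 (rename ρ Y)) (ext ρ) X)))
  where
  pointwise : ∀ n → rename ρ (sub0 Y n) ≡ sub0 (rename ρ Y) (ext ρ n)
  pointwise zero = refl
  pointwise (suc n) = refl

-- Tails and ⊤-variants.  The tail commutes with renaming and substitution,
-- and a topForm whose variable is bound inside it is closed, so being a
-- ⊤-variant is stable under substitution.
tail-rename : ∀ ρ A → tail (rename ρ A) ≡ rename ρ (tail A)
tail-rename ρ (var n) = refl
tail-rename ρ (A ⇒ B) = tail-rename ρ B
tail-rename ρ (● A) = cong ● (tail-rename ρ A)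
tail-rename ρ (μ A) = cong μ (tail-rename (ext ρ) A)

tail-subst : ∀ σ A → tail (subst σ A) ≡ subst (λ n → tail (σ n)) (tail A)
tail-subst σ (var n) = refl
tail-subst σ (A ⇒ B) = tail-subst σ B
tail-subst σ (● A) = cong ● (tail-subst σ A)
tail-subst σ (μ A) =
  cong μ (trans (tail-subst (exts σ) A) (subst-cong tail-exts (tail A)))
  where
  tail-exts : ∀ n → tail (exts σ n) ≡ exts (λ n → tail (σ n)) n
  tail-exts zero = refl
  tail-exts (suc n) = tail-rename suc (σ n)

subst-bullets : ∀ σ m A → subst σ (bullets m A) ≡ bullets m (subst σ A)
subst-bullets σ zero A = refl
subst-bullets σ (suc m) A = cong ● (subst-bullets σ m A)

subst-topForm : ∀ ms m₀ k σ → (∀ i → i + length ms ≤ k → σ i ≡ var i) →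
                subst σ (topForm m₀ ms k) ≡ topForm m₀ ms k
subst-topForm [] m₀ k σ fixes =
  trans (subst-bullets σ m₀ (var k))
    (cong (bullets m₀) (fixes k (≤-reflexive (+-identityʳ k))))
subst-topForm (m₁ ∷ ms) m₀ k σ fixes =
  trans (subst-bullets σ m₀ _)
    (cong (λ X → bullets m₀ (μ X)) (subst-topForm ms m₁ k (exts σ) exts-fixes))
  where
  exts-fixes : ∀ i → i + length ms ≤ k → exts σ i ≡ var i
  exts-fixes zero _ = refl
  exts-fixes (suc i) le =
    cong (rename suc) (fixes i (Eq.subst (_≤ k) (sym (+-suc i (length ms))) le))

topVariant-subst : ∀ σ T → IsTopVariant T → IsTopVariant (subst σ T)
topVariant-subst σ T (m₀ , ms , k , tail≡ , k<len , nonzero) =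
  m₀ , ms , k ,
  trans (tail-subst σ T)
    (trans (cong (subst _) tail≡) (subst-topForm ms m₀ k _ vacuous)) ,
  k<len , nonzero
  where
  vacuous : ∀ i → i + length ms ≤ k → _ ≡ var i
  vacuous i le = ⊥-elim (<⇒≱ k<len (≤-trans (m≤n+m (length ms) i) le))

topVariant-rename : ∀ ρ T → IsTopVariant T → IsTopVariant (rename ρ T)
topVariant-rename ρ T tv =
  Eq.subst IsTopVariant (sym (rename-as-subst ρ T)) (topVariant-subst _ T tv)

topForm-var : ∀ {n m₀ ms k} → var n ≡ topForm m₀ ms k → m₀ ≡ 0 × ms ≡ [] × n ≡ k
topForm-var {m₀ = zero} {[]} refl = refl , refl , refl
topForm-var {m₀ = zero} {_ ∷ _} ()
topForm-var {m₀ = suc _} {[]} ()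
topForm-var {m₀ = suc _} {_ ∷ _} ()

topForm-● : ∀ {A m₀ ms k} → ● A ≡ topForm m₀ ms k →
            ∃[ m ] (m₀ ≡ suc m × A ≡ topForm m ms k)
topForm-● {m₀ = zero} {[]} ()
topForm-● {m₀ = zero} {_ ∷ _} ()
topForm-● {m₀ = suc m} {[]} refl = m , refl , refl
topForm-● {m₀ = suc m} {_ ∷ _} refl = m , refl , refl

topForm-μ : ∀ {A m₀ ms k} → μ A ≡ topForm m₀ ms k →
            ∃[ m₁ ] ∃[ ms′ ] (m₀ ≡ 0 × ms ≡ m₁ ∷ ms′ × A ≡ topForm m₁ ms′ k)
topForm-μ {m₀ = zero} {[]} ()
topForm-μ {m₀ = zero} {m₁ ∷ ms′} refl = m₁ , ms′ , refl , refl , refl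
topForm-μ {m₀ = suc _} {[]} ()
topForm-μ {m₀ = suc _} {_ ∷ _} ()

proper-rename : ∀ {j} ρ X → Proper j X → (∀ k → ρ k ≡ ρ j → k ≡ j) →
                Proper (ρ j) (rename ρ X)
proper-rename ρ (var k) (pvar k≢j) inj = pvar (λ e → k≢j (inj k e))
proper-rename ρ (● X) pbul inj = pbul
proper-rename ρ (A ⇒ B) (parr p q) inj = parr (proper-rename ρ A p inj) (proper-rename ρ B q inj)
proper-rename ρ (A ⇒ B) (parrT tv) inj = parrT (topVariant-rename ρ B tv)
proper-rename {j} ρ (μ A) (pmu p) inj = pmu (proper-rename (ext ρ) A p ext-inj)
  where
  ext-inj : ∀ k → ext ρ k ≡ ext ρ (suc j) → k ≡ suc j
  ext-inj zero ()
  ext-inj (suc k) e = cong suc (inj k (suc-injective e))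
proper-rename ρ (μ A) (pmuT tv) inj = pmuT (topVariant-rename ρ (μ A) tv)

proper-rename-avoiding : ∀ {j} ρ X → (∀ k → ρ k ≢ j) → Proper j (rename ρ X)
proper-rename-avoiding ρ (var k) avoids = pvar (avoids k)
proper-rename-avoiding ρ (● X) avoids = pbul
proper-rename-avoiding ρ (A ⇒ B) avoids =
  parr (proper-rename-avoiding ρ A avoids) (proper-rename-avoiding ρ B avoids)
proper-rename-avoiding {j} ρ (μ A) avoids = pmu (proper-rename-avoiding (ext ρ) A ext-avoids)
  where
  ext-avoids : ∀ k → ext ρ k ≢ suc j
  ext-avoids zero ()
  ext-avoids (suc k) e = avoids k (suc-injective e)

proper-subst : ∀ {j j′} σ A → Proper j A → (∀ k → k ≢ j → Proper j′ (σ k)) →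
               Proper j′ (subst σ A)
proper-subst σ (var k) (pvar k≢j) prop = prop k k≢j
proper-subst σ (● A) pbul prop = pbul
proper-subst σ (A ⇒ B) (parr p q) prop = parr (proper-subst σ A p prop) (proper-subst σ B q prop)
proper-subst σ (A ⇒ B) (parrT tv) prop = parrT (topVariant-subst σ B tv)
proper-subst {j} {j′} σ (μ A) (pmu p) prop = pmu (proper-subst (exts σ) A p exts-prop)
  where
  exts-prop : ∀ k → k ≢ suc j → Proper (suc j′) (exts σ k)
  exts-prop zero _ = pvar (λ ())
  exts-prop (suc k) k≢ =
    proper-rename suc (σ k) (prop k (λ e → k≢ (cong suc e))) (λ _ e → suc-injective e)
proper-subst σ (μ A) (pmuT tv) prop = pmuT (topVariant-subst σ (μ A) tv)

isType-rename : ∀ ρ A → IsType A → IsType (rename ρ A)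
isType-rename ρ (var n) tvar = tvar
isType-rename ρ (A ⇒ B) (tarr a b) = tarr (isType-rename ρ A a) (isType-rename ρ B b)
isType-rename ρ (● A) (tbul a) = tbul (isType-rename ρ A a)
isType-rename ρ (μ A) (tmu a p) =
  tmu (isType-rename (ext ρ) A a) (proper-rename (ext ρ) A p ext-inj)
  where
  ext-inj : ∀ k → ext ρ k ≡ 0 → k ≡ 0
  ext-inj zero _ = refl
  ext-inj (suc k) ()

WfSubst : (ℕ → Ty) → Set
WfSubst σ = ∀ n → IsType (σ n)

exts-wf : ∀ {σ} → WfSubst σ → WfSubst (exts σ)
exts-wf wf zero = tvar
exts-wf wf (suc n) = isType-rename suc _ (wf n)

isType-subst : ∀ σ A → WfSubst σ → IsType A → IsType (subst σ A)
isType-subst σ (var n) wf tvar = wf n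
isType-subst σ (A ⇒ B) wf (tarr a b) = tarr (isType-subst σ A wf a) (isType-subst σ B wf b)
isType-subst σ (● A) wf (tbul a) = tbul (isType-subst σ A wf a)
isType-subst σ (μ A) wf (tmu a p) =
  tmu (isType-subst (exts σ) A (exts-wf wf) a) (proper-subst (exts σ) A p avoid0)
  where
  avoid0 : ∀ k → k ≢ 0 → Proper 0 (exts σ k)
  avoid0 zero k≢0 = ⊥-elim (k≢0 refl)
  avoid0 (suc k) _ = proper-rename-avoiding suc (σ k) (λ _ ())

sub0-wf : ∀ {T} → IsType T → WfSubst (sub0 T)
sub0-wf t zero = t
sub0-wf t (suc n) = tvar

cons-wf : ∀ {T σ} → IsType T → WfSubst σ → WfSubst (cons T σ)
cons-wf t wf zero = t
cons-wf t wf (suc n) = wf n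

⊤-isType : IsType ⊤ᵗ
⊤-isType = tmu (tbul tvar) pbul

μ-body : ∀ {A} → IsType (μ A) → IsType A
μ-body (tmu a _) = a

μ-proper : ∀ {A} → IsType (μ A) → Proper 0 A
μ-proper (tmu _ p) = p

peel : Ty → Ty
peel (var n) = var n
peel (A ⇒ B) = peel A ⇒ peel B
peel (● A) = A
peel (μ A) = (peel A) [ μ A /0]

isType-peel : ∀ A → IsType A → IsType (peel A)
isType-peel (var n) t = tvar
isType-peel (A ⇒ B) (tarr a b) = tarr (isType-peel A a) (isType-peel B b)
isType-peel (● A) (tbul a) = a
isType-peel (μ A) t = isType-subst _ (peel A) (sub0-wf t) (isType-peel A (μ-body t))

peel-rename : ∀ ρ A → peel (rename ρ A) ≡ rename ρ (peel A)
peel-rename ρ (var n) = refl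
peel-rename ρ (A ⇒ B) = cong₂ _⇒_ (peel-rename ρ A) (peel-rename ρ B)
peel-rename ρ (● A) = refl
peel-rename ρ (μ A) =
  trans (cong (_[ rename ρ (μ A) /0]) (peel-rename (ext ρ) A))
    (sym (rename-fusion ρ (peel A) (μ A)))

data Side : Set where
  dom cod : Side

select : Side → Ty → Ty → Ty
select dom A B = A
select cod A B = B

component : Side → Ty → Ty
component s (var n) = var n
component s (A ⇒ B) = select s A B
component s (● A) = ● (component s A)
component s (μ A) = (component s A) [ μ A /0]

isType-select : ∀ s {A B} → IsType A → IsType B → IsType (select s A B)
isType-select dom a b = a
isType-select cod a b = b

isType-component : ∀ s A → IsType A → IsType (component s A)
isType-component s (var n) t = tvar
isType-component s (A ⇒ B) (tarr a b) = isType-select s a b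
isType-component s (● A) (tbul a) = tbul (isType-component s A a)
isType-component s (μ A) t =
  isType-subst _ (component s A) (sub0-wf t) (isType-component s A (μ-body t))

select-subst : ∀ s σ A B → select s (subst σ A) (subst σ B) ≡ subst σ (select s A B)
select-subst dom σ A B = refl
select-subst cod σ A B = refl

select-rename : ∀ s ρ A B → select s (rename ρ A) (rename ρ B) ≡ rename ρ (select s A B)
select-rename dom ρ A B = refl
select-rename cod ρ A B = refl

component-rename : ∀ s ρ A → component s (rename ρ A) ≡ rename ρ (component s A)
component-rename s ρ (var n) = refl
component-rename s ρ (A ⇒ B) = select-rename s ρ A B
component-rename s ρ (● A) = cong ● (component-rename s ρ A)
component-rename s ρ (μ A) =
  trans (cong (_[ rename ρ (μ A) /0]) (component-rename s (ext ρ) A))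
    (sym (rename-fusion ρ (component s A) (μ A)))

data Chain : Ty → Set where
  chain-var : ∀ {k} → Chain (var k)
  chain-● : ∀ {A} → Chain A → Chain (● A)
  chain-μ : ∀ {A} → Chain A → Chain (μ A)

-- Spine A k: A is arrow-free and ends in the free variable k.  These are
-- exactly the variables that component s reaches without meeting an arrow.
data Spine : Ty → ℕ → Set where
  spine-var : ∀ {k} → Spine (var k) k
  spine-● : ∀ {A k} → Spine A k → Spine (● A) k
  spine-μ : ∀ {A k} → Spine A (suc k) → Spine (μ A) k

spine-chain : ∀ {A k} → Spine A k → Chain A
spine-chain spine-var = chain-var
spine-chain (spine-● s) = chain-● (spine-chain s)
spine-chain (spine-μ s) = chain-μ (spine-chain s)

spine? : ∀ A k → Dec (Spine A k)
spine? (var n) k with n ≟ k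
... | yes refl = yes spine-var
... | no n≢k = no λ { spine-var → n≢k refl }
spine? (A ⇒ B) k = no λ ()
spine? (● A) k with spine? A k
... | yes s = yes (spine-● s)
... | no ¬s = no λ { (spine-● s) → ¬s s }
spine? (μ A) k with spine? A (suc k)
... | yes s = yes (spine-μ s)
... | no ¬s = no λ { (spine-μ s) → ¬s s }

subst-spine : ∀ {C j} σ τ → Spine C j → σ j ≡ τ j → subst σ C ≡ subst τ C
subst-spine σ τ spine-var e = e
subst-spine σ τ (spine-● s) e = cong ● (subst-spine σ τ s e)
subst-spine σ τ (spine-μ s) e = cong μ (subst-spine (exts σ) (exts τ) s (cong (rename suc) e))

-- Under L binders the variable k refers to the outer variable k ∸ L (when
-- L ≤ k); TargetIs⊤ σ L k says that σ maps that outer variable to ⊤.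
TargetIs⊤ : (ℕ → Ty) → ℕ → ℕ → Set
TargetIs⊤ σ L k = L ≤ k → σ (k ∸ L) ≡ ⊤ᵗ

cons⊤-target : ∀ σ L k → TargetIs⊤ σ (suc L) k → TargetIs⊤ (cons ⊤ᵗ σ) L k
cons⊤-target σ zero zero target _ = refl
cons⊤-target σ zero (suc k) target _ = target (s≤s z≤n)
cons⊤-target σ (suc L) (suc k) target (s≤s L≤k) =
  cons⊤-target σ L k (λ { (s≤s le) → target (s≤s (s≤s le)) }) L≤k

module Equivalence (d : Bool) where

  infix 4 _∼_
  _∼_ : Ty → Ty → Set
  _∼_ = Equiv d

  ≡⇒∼ : ∀ {A B} → IsType A → A ≡ B → A ∼ B
  ≡⇒∼ a refl = e-refl a

  ∼-trans-≡ : ∀ {A B C} → A ∼ B → B ≡ C → A ∼ C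
  ∼-trans-≡ e refl = e

  ≡-trans-∼ : ∀ {A B C} → A ≡ B → B ∼ C → A ∼ C
  ≡-trans-∼ refl e = e

  regular : ∀ {A B} → A ∼ B → IsType A × IsType B
  regular (e-refl a) = a , a
  regular (e-sym e) = proj₂ (regular e) , proj₁ (regular e)
  regular (e-trans e f) = proj₁ (regular e) , proj₂ (regular f)
  regular (e-bul e) = tbul (proj₁ (regular e)) , tbul (proj₂ (regular e))
  regular (e-arr e f) =
    tarr (proj₁ (regular e)) (proj₁ (regular f)) , tarr (proj₂ (regular e)) (proj₂ (regular f))
  regular (e-top a) = tarr a ⊤-isType , ⊤-isType
  regular {μ A} (e-fold t) = t , isType-subst _ A (sub0-wf t) (μ-body t)
  regular (e-contr c p e) = proj₁ (regular e) , tmu c p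
  regular (e-dist _ a b) = tbul (tarr a b) , tarr (tbul a) (tbul b)

  lhs-isType : ∀ {A B} → A ∼ B → IsType A
  lhs-isType e = proj₁ (regular e)

  rhs-isType : ∀ {A B} → A ∼ B → IsType B
  rhs-isType e = proj₂ (regular e)

  ⊤-unfold : ⊤ᵗ ∼ ● ⊤ᵗ
  ⊤-unfold = e-fold ⊤-isType

  subst-resp : ∀ {A B} σ → WfSubst σ → A ∼ B → subst σ A ∼ subst σ B
  subst-resp σ wf (e-refl a) = e-refl (isType-subst σ _ wf a)
  subst-resp σ wf (e-sym e) = e-sym (subst-resp σ wf e)
  subst-resp σ wf (e-trans e f) = e-trans (subst-resp σ wf e) (subst-resp σ wf f)
  subst-resp σ wf (e-bul e) = e-bul (subst-resp σ wf e)
  subst-resp σ wf (e-arr e f) = e-arr (subst-resp σ wf e) (subst-resp σ wf f)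
  subst-resp σ wf (e-top a) = e-top (isType-subst σ _ wf a)
  subst-resp σ wf (e-fold {A} t) =
    ∼-trans-≡ (e-fold (isType-subst σ (μ A) wf t)) (sym (subst-fusion σ A (μ A)))
  subst-resp σ wf (e-contr {A} {C} c p e) =
    e-contr (isType-subst (exts σ) C (exts-wf wf) c)
            (μ-proper (isType-subst σ (μ C) wf (tmu c p)))
            (∼-trans-≡ (subst-resp σ wf e) (subst-fusion σ C A))
  subst-resp σ wf (e-dist q a b) = e-dist q (isType-subst σ _ wf a) (isType-subst σ _ wf b)

  rename-resp : ∀ {A B} ρ → A ∼ B → rename ρ A ∼ rename ρ B
  rename-resp {A} {B} ρ e =
    ≡-trans-∼ (rename-as-subst ρ A)
      (∼-trans-≡ (subst-resp (λ n → var (ρ n)) (λ _ → tvar) e) (sym (rename-as-subst ρ B)))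

  μ-cong : ∀ {H₁ H₂} → Proper 0 H₂ → IsType (μ H₁) → H₁ ∼ H₂ → μ H₁ ∼ μ H₂
  μ-cong {H₁} p t e =
    e-contr (rhs-isType e) p (e-trans (e-fold t) (subst-resp (sub0 (μ H₁)) (sub0-wf t) e))

  subst-pointwise : ∀ {σ τ} → WfSubst σ → WfSubst τ → (∀ n → σ n ∼ τ n) →
                    ∀ X → IsType X → subst σ X ∼ subst τ X
  subst-pointwise wfσ wfτ e (var n) tvar = e n
  subst-pointwise wfσ wfτ e (A ⇒ B) (tarr a b) =
    e-arr (subst-pointwise wfσ wfτ e A a) (subst-pointwise wfσ wfτ e B b)
  subst-pointwise wfσ wfτ e (● A) (tbul a) = e-bul (subst-pointwise wfσ wfτ e A a)
  subst-pointwise {σ} {τ} wfσ wfτ e (μ A) t =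
    μ-cong (μ-proper (isType-subst τ (μ A) wfτ t)) (isType-subst σ (μ A) wfσ t)
           (subst-pointwise (exts-wf wfσ) (exts-wf wfτ) exts-e A (μ-body t))
    where
    exts-e : ∀ n → exts σ n ∼ exts τ n
    exts-e zero = e-refl tvar
    exts-e (suc n) = rename-resp suc (e n)

  [/0]-cong : ∀ {S T} → S ∼ T → ∀ X → IsType X → X [ S /0] ∼ X [ T /0]
  [/0]-cong {S} {T} e = subst-pointwise (sub0-wf (lhs-isType e)) (sub0-wf (rhs-isType e)) sub0-e
    where
    sub0-e : ∀ n → sub0 S n ∼ sub0 T n
    sub0-e zero = e
    sub0-e (suc n) = e-refl tvar

  ⇒-⊤ : ∀ {A B} → IsType A → B ∼ ⊤ᵗ → (A ⇒ B) ∼ ⊤ᵗ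
  ⇒-⊤ a e = e-trans (e-arr (e-refl a) e) (e-top a)

  ●-⊤ : ∀ {A} → A ∼ ⊤ᵗ → ● A ∼ ⊤ᵗ
  ●-⊤ e = e-trans (e-bul e) (e-sym ⊤-unfold)

  -- A μ whose body becomes ⊤ when ⊤ is substituted for its variable is ⊤,
  -- because ⊤ is then a fixed point of the (proper) body.
  μ-⊤ : ∀ {A} σ → WfSubst σ → IsType (μ A) → subst (cons ⊤ᵗ σ) A ∼ ⊤ᵗ →
        subst σ (μ A) ∼ ⊤ᵗ
  μ-⊤ {A} σ wf t e =
    e-sym (e-contr (μ-body t′) (μ-proper t′) (∼-trans-≡ (e-sym e) (sym (exts-[/0] σ A ⊤ᵗ))))
    where
    t′ : IsType (subst σ (μ A))
    t′ = isType-subst σ (μ A) wf t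

  tail-⊤ : ∀ T m₀ ms k σ → IsType T → WfSubst σ → tail T ≡ topForm m₀ ms k →
           TargetIs⊤ σ (length ms) k → subst σ T ∼ ⊤ᵗ
  tail-⊤ (var n) m₀ ms k σ t wf tail≡ target with topForm-var {m₀ = m₀} {ms} {k} tail≡
  ... | refl , refl , refl = ≡⇒∼ (wf n) (target z≤n)
  tail-⊤ (A ⇒ B) m₀ ms k σ (tarr a b) wf tail≡ target =
    ⇒-⊤ (isType-subst σ A wf a) (tail-⊤ B m₀ ms k σ b wf tail≡ target)
  tail-⊤ (● A) m₀ ms k σ (tbul a) wf tail≡ target with topForm-● {m₀ = m₀} {ms} {k} tail≡
  ... | m , refl , tail≡′ = ●-⊤ (tail-⊤ A m ms k σ a wf tail≡′ target)
  tail-⊤ (μ A) m₀ ms k σ t wf tail≡ target with topForm-μ {m₀ = m₀} {ms} {k} tail≡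
  ... | m₁ , ms′ , refl , refl , tail≡′ =
    μ-⊤ σ wf t (tail-⊤ A m₁ ms′ k (cons ⊤ᵗ σ) (μ-body t) (cons-wf ⊤-isType wf) tail≡′
                  (cons⊤-target σ (length ms′) k target))

  -- Every ⊤-variant is ⊤: its tail ends in a bound variable.
  topVariant-⊤ : ∀ T σ → IsTopVariant T → IsType T → WfSubst σ → subst σ T ∼ ⊤ᵗ
  topVariant-⊤ T σ (m₀ , ms , k , tail≡ , k<len , _) t wf =
    tail-⊤ T m₀ ms k σ t wf tail≡ (λ len≤k → ⊥-elim (<⇒≱ k<len len≤k))

  peel-tail-⊤ : ∀ T m₀ ms k σ → IsType T → WfSubst σ → tail T ≡ topForm m₀ ms k →
                TargetIs⊤ σ (length ms) k → subst σ (peel T) ∼ ⊤ᵗ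
  peel-tail-⊤ (var n) m₀ ms k σ t wf tail≡ target with topForm-var {m₀ = m₀} {ms} {k} tail≡
  ... | refl , refl , refl = ≡⇒∼ (wf n) (target z≤n)
  peel-tail-⊤ (A ⇒ B) m₀ ms k σ (tarr a b) wf tail≡ target =
    ⇒-⊤ (isType-subst σ (peel A) wf (isType-peel A a)) (peel-tail-⊤ B m₀ ms k σ b wf tail≡ target)
  peel-tail-⊤ (● A) m₀ ms k σ (tbul a) wf tail≡ target with topForm-● {m₀ = m₀} {ms} {k} tail≡
  ... | m , refl , tail≡′ = tail-⊤ A m ms k σ a wf tail≡′ target
  peel-tail-⊤ (μ A) m₀ ms k σ t wf tail≡ target with topForm-μ {m₀ = m₀} {ms} {k} tail≡
  ... | m₁ , ms′ , refl , refl , tail≡′ =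
    ≡-trans-∼ (subst-[/0] σ (peel A) (μ A))
      (e-trans (subst-pointwise (cons-wf (isType-subst σ (μ A) wf t) wf)
                                (cons-wf ⊤-isType wf) unfolding-⊤ (peel A) (isType-peel A a))
               (peel-tail-⊤ A m₁ ms′ k (cons ⊤ᵗ σ) a (cons-wf ⊤-isType wf) tail≡′
                  (cons⊤-target σ (length ms′) k target)))
    where
    a : IsType A
    a = μ-body t
    unfolding-⊤ : ∀ n → cons (subst σ (μ A)) σ n ∼ cons ⊤ᵗ σ n
    unfolding-⊤ zero = tail-⊤ (μ A) 0 (m₁ ∷ ms′) k σ t wf tail≡ target
    unfolding-⊤ (suc n) = e-refl (wf n)

  peel-topVariant-⊤ : ∀ T σ → IsTopVariant T → IsType T → WfSubst σ →
                      subst σ (peel T) ∼ ⊤ᵗ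
  peel-topVariant-⊤ T σ (m₀ , ms , k , tail≡ , k<len , _) t wf =
    peel-tail-⊤ T m₀ ms k σ t wf tail≡ (λ len≤k → ⊥-elim (<⇒≱ k<len len≤k))

  peel-topVariant-⊤₀ : ∀ T → IsTopVariant T → IsType T → peel T ∼ ⊤ᵗ
  peel-topVariant-⊤₀ T tv t =
    ≡-trans-∼ (sym (subst-id (peel T))) (peel-topVariant-⊤ T var tv t (λ _ → tvar))

  -- Peeling commutes (up to ∼) with a substitution into a type proper in j,
  -- provided peeling fixes the substituted types other than the one for j:
  -- the variable j only occurs under a bullet (where peel stops) or inside
  -- a ⊤-variant codomain (where both sides are ⊤).
  peel-subst : ∀ {j} σ A → Proper j A → IsType A → WfSubst σ →
               (∀ k → k ≢ j → peel (σ k) ≡ σ k) → peel (subst σ A) ∼ subst σ (peel A)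
  peel-subst σ (var k) (pvar k≢j) t wf fixed = ≡⇒∼ (isType-peel _ (wf k)) (fixed k k≢j)
  peel-subst σ (● A) pbul (tbul a) wf fixed = e-refl (isType-subst σ A wf a)
  peel-subst σ (A ⇒ B) (parr p q) (tarr a b) wf fixed =
    e-arr (peel-subst σ A p a wf fixed) (peel-subst σ B q b wf fixed)
  peel-subst σ (A ⇒ B) (parrT tv) (tarr a b) wf fixed =
    e-trans (⇒-⊤ (isType-peel _ (isType-subst σ A wf a))
                 (peel-topVariant-⊤₀ _ (topVariant-subst σ B tv) (isType-subst σ B wf b)))
            (e-sym (⇒-⊤ (isType-subst σ _ wf (isType-peel A a)) (peel-topVariant-⊤ B σ tv b wf)))
  peel-subst {j} σ (μ A) (pmu p) t wf fixed =
    ∼-trans-≡ (subst-resp (sub0 (subst σ (μ A))) (sub0-wf (isType-subst σ (μ A) wf t))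
                 (peel-subst (exts σ) A p (μ-body t) (exts-wf wf) exts-fixed))
              (sym (subst-fusion σ (peel A) (μ A)))
    where
    exts-fixed : ∀ k → k ≢ suc j → peel (exts σ k) ≡ exts σ k
    exts-fixed zero _ = refl
    exts-fixed (suc k) k≢ =
      trans (peel-rename suc (σ k)) (cong (rename suc) (fixed k (λ e → k≢ (cong suc e))))
  peel-subst σ (μ A) (pmuT tv) t wf fixed =
    e-trans (peel-topVariant-⊤₀ _ (topVariant-subst σ (μ A) tv) (isType-subst σ (μ A) wf t))
            (e-sym (peel-topVariant-⊤ (μ A) σ tv t wf))

  peel-resp : ∀ {A B} → A ∼ B → peel A ∼ peel B
  peel-resp (e-refl a) = e-refl (isType-peel _ a)
  peel-resp (e-sym e) = e-sym (peel-resp e)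
  peel-resp (e-trans e f) = e-trans (peel-resp e) (peel-resp f)
  peel-resp (e-bul e) = e
  peel-resp (e-arr e f) = e-arr (peel-resp e) (peel-resp f)
  peel-resp (e-top a) = e-top (isType-peel _ a)
  peel-resp (e-fold {A} t) =
    e-sym (peel-subst (sub0 (μ A)) A (μ-proper t) (μ-body t) (sub0-wf t) sub0-fixed)
    where
    sub0-fixed : ∀ k → k ≢ 0 → peel (sub0 (μ A) k) ≡ sub0 (μ A) k
    sub0-fixed zero k≢0 = ⊥-elim (k≢0 refl)
    sub0-fixed (suc k) _ = refl
  peel-resp A∼μC@(e-contr {A} {C} c p e) =
    e-trans (peel-resp e)
      (e-trans (peel-subst (sub0 A) C p c (sub0-wf (lhs-isType e)) sub0-fixed)
               ([/0]-cong A∼μC (peel C) (isType-peel C c)))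
    where
    sub0-fixed : ∀ k → k ≢ 0 → peel (sub0 A k) ≡ sub0 A k
    sub0-fixed zero k≢0 = ⊥-elim (k≢0 refl)
    sub0-fixed (suc k) _ = refl
  peel-resp (e-dist _ a b) = e-refl (tarr a b)

  component-subst : ∀ s σ A → IsType A → WfSubst σ →
                    (∀ k → Spine A k → component s (σ k) ∼ σ k) →
                    component s (subst σ A) ∼ subst σ (component s A)
  component-subst s σ (var n) t wf fixed = fixed n spine-var
  component-subst s σ (A ⇒ B) (tarr a b) wf fixed =
    ≡⇒∼ (isType-select s (isType-subst σ A wf a) (isType-subst σ B wf b)) (select-subst s σ A B)
  component-subst s σ (● A) (tbul a) wf fixed =
    e-bul (component-subst s σ A a wf (λ k sp → fixed k (spine-● sp)))
  component-subst s σ (μ A) t wf fixed =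
    ∼-trans-≡ (subst-resp (sub0 (subst σ (μ A))) (sub0-wf (isType-subst σ (μ A) wf t))
                 (component-subst s (exts σ) A (μ-body t) (exts-wf wf) exts-fixed))
              (sym (subst-fusion σ (component s A) (μ A)))
    where
    exts-fixed : ∀ k → Spine A k → component s (exts σ k) ∼ exts σ k
    exts-fixed zero _ = e-refl tvar
    exts-fixed (suc k) sp =
      ≡-trans-∼ (component-rename s suc (σ k)) (rename-resp suc (fixed k (spine-μ sp)))

  chain-component : ∀ s A → IsType A → Chain A → component s A ∼ A
  chain-component s (var n) t chain-var = e-refl tvar
  chain-component s (● A) (tbul a) (chain-● ch) = e-bul (chain-component s A a ch)
  chain-component s (μ A) t (chain-μ ch) =
    e-trans (subst-resp (sub0 (μ A)) (sub0-wf t) (chain-component s A (μ-body t) ch))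
            (e-sym (e-fold t))

  spine-component : ∀ s C j σ τ → Spine C j → IsType C → WfSubst σ → WfSubst τ →
                    component s (σ j) ∼ τ j → component s (subst σ C) ∼ subst τ C
  spine-component s (var j) j σ τ spine-var t wfσ wfτ e = e
  spine-component s (● C) j σ τ (spine-● sp) (tbul c) wfσ wfτ e =
    e-bul (spine-component s C j σ τ sp c wfσ wfτ e)
  spine-component s (μ C) j σ τ (spine-μ sp) t wfσ wfτ e =
    e-trans (subst-resp (sub0 μσ) (sub0-wf (isType-subst σ (μ C) wfσ t))
               (spine-component s C (suc j) (exts σ) (exts τ) sp (μ-body t)
                  (exts-wf wfσ) (exts-wf wfτ)
                  (≡-trans-∼ (component-rename s suc (σ j)) (rename-resp suc e))))
            (≡-trans-∼ only-spine-matters (e-sym (e-fold (isType-subst τ (μ C) wfτ t))))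
    where
    μσ μτ : Ty
    μσ = subst σ (μ C)
    μτ = subst τ (μ C)
    only-spine-matters : (subst (exts τ) C) [ μσ /0] ≡ (subst (exts τ) C) [ μτ /0]
    only-spine-matters =
      trans (exts-[/0] τ C μσ)
        (trans (subst-spine (cons μσ τ) (cons μτ τ) sp refl) (sym (exts-[/0] τ C μτ)))

  -- Invariance of component s can only fail through A→⊤ ∼ ⊤ on the domain
  -- side, and then the type at hand is ⊤.
  Escape : Side → Ty → Set
  Escape dom A = A ∼ ⊤ᵗ
  Escape cod A = ⊥

  escape-back : ∀ s {A B} → A ∼ B → Escape s B → Escape s A
  escape-back dom e B∼⊤ = e-trans e B∼⊤
  escape-back cod e ()

  escape-● : ∀ s {A} → Escape s A → Escape s (● A)
  escape-● dom A∼⊤ = ●-⊤ A∼⊤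
  escape-● cod ()

  -- If the spine of C ends at
  -- its bound variable, component s A is itself a fixed point of C;
  -- otherwise component s commutes with the substitution C[A/0].
  component-contr : ∀ s {A C} → IsType C → Proper 0 C → A ∼ C [ A /0] →
                    component s A ∼ component s (C [ A /0]) → component s A ∼ component s (μ C)
  component-contr s {A} {C} c p e x with spine? C 0
  ... | no ¬sp =
    e-trans x (e-trans (component-subst s (sub0 A) C c (sub0-wf a) off-spine)
                       ([/0]-cong (e-contr c p e) (component s C) (isType-component s C c)))
    where
    a : IsType A
    a = lhs-isType e
    off-spine : ∀ k → Spine C k → component s (sub0 A k) ∼ sub0 A k
    off-spine zero sp = ⊥-elim (¬sp sp)
    off-spine (suc k) _ = e-refl tvar
  ... | yes sp =
    e-trans (e-contr c p (e-trans x (spine-component s C 0 (sub0 A) (sub0 (component s A))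
                                       sp c (sub0-wf a) (sub0-wf cA) (e-refl cA))))
            (e-sym (chain-component s (μ C) (tmu c p) (chain-μ (spine-chain sp))))
    where
    a : IsType A
    a = lhs-isType e
    cA : IsType (component s A)
    cA = isType-component s A a

  component-resp : ∀ s {A B} → A ∼ B → component s A ∼ component s B ⊎ Escape s A
  component-resp s (e-refl a) = inj₁ (e-refl (isType-component s _ a))
  component-resp s (e-sym e) = Sum.map e-sym (escape-back s (e-sym e)) (component-resp s e)
  component-resp s (e-trans e f) with component-resp s e | component-resp s f
  ... | inj₂ esc | _ = inj₂ esc
  ... | inj₁ x | inj₁ y = inj₁ (e-trans x y)
  ... | inj₁ _ | inj₂ esc = inj₂ (escape-back s e esc)
  component-resp s (e-bul e) = Sum.map e-bul (escape-● s) (component-resp s e)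
  component-resp dom (e-arr e f) = inj₁ e
  component-resp cod (e-arr e f) = inj₁ f
  component-resp dom (e-top a) = inj₂ (e-top a)
  component-resp cod (e-top a) = inj₁ ⊤-unfold
  component-resp s (e-fold {A} t) =
    inj₁ (e-sym (component-subst s (sub0 (μ A)) A (μ-body t) (sub0-wf t) sub0-fixed))
    where
    sub0-fixed : ∀ k → Spine A k → component s (sub0 (μ A) k) ∼ sub0 (μ A) k
    sub0-fixed zero sp = chain-component s (μ A) t (chain-μ (spine-chain sp))
    sub0-fixed (suc k) _ = e-refl tvar
  component-resp s (e-contr c p e) = Sum.map₁ (component-contr s c p e) (component-resp s e)
  component-resp dom (e-dist _ a b) = inj₁ (e-refl (tbul a))
  component-resp cod (e-dist _ a b) = inj₁ (e-refl (tbul b))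

  codomain-resp : ∀ {A B} → A ∼ B → component cod A ∼ component cod B
  codomain-resp e = Sum.[ (λ x → x) , (λ ()) ] (component-resp cod e)

  -- An arrow equivalent to ⊤ has codomain ⊤ (as component cod ⊤ = •⊤).
  ⇒-⊤-codomain : ∀ {A B} → (A ⇒ B) ∼ ⊤ᵗ → B ∼ ⊤ᵗ
  ⇒-⊤-codomain e = e-trans (codomain-resp e) (e-sym ⊤-unfold)

proposition4p29 : (d : Bool) → (A B C D : Ty) →
    IsType A → IsType B → IsType C → IsType D →
    (Equiv d (● A) (● B) ⇔ Equiv d A B) ×
    (Equiv d (A ⇒ B) (C ⇒ D) ⇔
      ((Equiv d A C × Equiv d B D) ⊎ (Equiv d B D × Equiv d D ⊤ᵗ)))
proposition4p29 d A B C D a _ c _ = mk⇔ peel-resp e-bul , mk⇔ arrow-inversion arrow-intro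
  where
  open Equivalence d

  -- The domains are equivalent unless the arrows are ⊤, in which case so
  -- are the (always equivalent) codomains.
  arrow-inversion : A ⇒ B ∼ C ⇒ D → (A ∼ C × B ∼ D) ⊎ (B ∼ D × D ∼ ⊤ᵗ)
  arrow-inversion e =
    Sum.map (_, B∼D) (λ A⇒B∼⊤ → B∼D , e-trans (e-sym B∼D) (⇒-⊤-codomain A⇒B∼⊤))
            (component-resp dom e)
    where
    B∼D : B ∼ D
    B∼D = codomain-resp e

  arrow-intro : (A ∼ C × B ∼ D) ⊎ (B ∼ D × D ∼ ⊤ᵗ) → A ⇒ B ∼ C ⇒ D
  arrow-intro (inj₁ (A∼C , B∼D)) = e-arr A∼C B∼D
  arrow-intro (inj₂ (B∼D , D∼⊤)) = e-trans (⇒-⊤ a (e-trans B∼D D∼⊤)) (e-sym (⇒-⊤ c D∼⊤))
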